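{- For every integer $q\ge1$, $s_q\le\sqrt q$.
   Context: For $q\ge2$, $s_q$ is the cardinality of $\{p\in\mathbb{Z}: 1\le p<q,\ p^2\equiv-1\pmod q\}$, and by convention $s_1=1$. -}

module Defs where

open import Data.Nat using (ℕ; zero; suc; _+_; _*_; _≤?_; _<?_)
open import Data.Nat.Divisibility using (_∣_; _∣?_)
open import Data.List using (List; length; filter; upTo)
open import Relation.Nullary using (Dec)
open import Relation.Nullary.Decidable using (_×-dec_)
open import Data.Product using (_×_)

IsSqrtMinusOne : ℕ → ℕ → Set
IsSqrtMinusOne q p = (1 Data.Nat.≤ p) × (q ∣ p * p + 1)

isSqrtMinusOne? : (q p : ℕ) → Dec (IsSqrtMinusOne q p)
isSqrtMinusOne? q p = (1 ≤? p) ×-dec (q ∣? p * p + 1)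

-- s q = #{ p : 1 ≤ p < q, p^2 ≡ -1 (mod q) } for q ≥ 2, and s 1 = 1 by convention.
-- (s 0 is irrelevant; it is 0 here.)
s : ℕ → ℕ
s 0 = 0
s 1 = 1
s q@(suc (suc _)) = length (filter (isSqrtMinusOne? q) (upTo q))

-- If a + 2b ≡ a' + 2b' (mod q) for square roots a, b, a', b' of -1 modulo q, put d = b' - b.
-- Then a - a' ≡ 2d, and comparing a² ≡ a'² and b² ≡ b'² gives 4d (a' + 2b') ≡ 0, while
-- (a' + 2b')(a' - 2b') = a'² - 4b'² ≡ 3; hence 12 d ≡ 0. A modulus admitting a square root
-- of -1 is divisible by neither 3 nor 4, and when it is even all roots are odd, so d ≡ 0 and
-- then a ≡ a'. Thus (a, b) ↦ a + 2b mod q is injective on pairs of roots, and s q * s q ≤ q.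
module Submission where

open import Data.Product using (_×_; _,_; proj₁; proj₂)
open import Data.Sum using (inj₁; inj₂)
open import Relation.Nullary using (¬_; yes; no; contradiction; ¬?)
open import Relation.Nullary.Decidable using (from-yes; from-no)
open import Relation.Binary.PropositionalEquality

open import Defs

module Residues where
  open import Data.Fin using (Fin; toℕ; fromℕ<)
  import Data.Fin.Properties as Fin
  open import Data.Nat.Base
  open import Data.Nat.Coprimality using (Coprime)
  open import Data.Nat.Divisibility using (_∣_; _∣?_; m%n≡0⇒n∣m; n∣m⇒m%n≡0; >⇒∤)
  open import Data.Nat.DivMod
  open import Data.Nat.Primality using (Prime; prime⇒irreducible)

  ReducedRoot : ℕ → ℕ → Set
  ReducedRoot q a = a < q × q ∣ a * a + 1

  sq+1-% : ∀ p k .{{_ : NonZero k}} → (p * p + 1) % k ≡ ((p % k) * (p % k) + 1) % k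
  sq+1-% p k = begin
    (p * p + 1) % k                           ≡⟨ %-distribˡ-+ (p * p) 1 k ⟩
    ((p * p) % k + 1 % k) % k                 ≡⟨ cong (λ r → (r + 1 % k) % k) (%-distribˡ-* p p k) ⟩
    (((p % k) * (p % k)) % k + 1 % k) % k     ≡⟨ %-distribˡ-+ ((p % k) * (p % k)) 1 k ⟨
    ((p % k) * (p % k) + 1) % k               ∎
    where open ≡-Reasoning

  ∣sq+1⇒∣[%]²+1 : ∀ {k} .{{_ : NonZero k}} p → k ∣ p * p + 1 → k ∣ (p % k) * (p % k) + 1
  ∣sq+1⇒∣[%]²+1 {k} p k∣ = m%n≡0⇒n∣m _ k (trans (sym (sq+1-% p k)) (n∣m⇒m%n≡0 _ k k∣))

  ¬∣sq+1 : ∀ k .{{_ : NonZero k}} → (∀ (r : Fin k) → ¬ k ∣ toℕ r * toℕ r + 1) → ∀ p → ¬ k ∣ p * p + 1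
  ¬∣sq+1 k noResidue p k∣ = noResidue (fromℕ< (m%n<n p k))
    (subst (λ r → k ∣ r * r + 1) (sym (Fin.toℕ-fromℕ< (m%n<n p k))) (∣sq+1⇒∣[%]²+1 p k∣))

  ¬3∣sq+1 : ∀ p → ¬ 3 ∣ p * p + 1
  ¬3∣sq+1 = ¬∣sq+1 3 (from-yes (Fin.all? λ (r : Fin 3) → ¬? (3 ∣? toℕ r * toℕ r + 1)))

  ¬4∣sq+1 : ∀ p → ¬ 4 ∣ p * p + 1
  ¬4∣sq+1 = ¬∣sq+1 4 (from-yes (Fin.all? λ (r : Fin 4) → ¬? (4 ∣? toℕ r * toℕ r + 1)))

  2∣sq+1⇒odd : ∀ p → 2 ∣ p * p + 1 → p % 2 ≡ 1
  2∣sq+1⇒odd p 2∣ with p % 2 | m%n<n p 2 | ∣sq+1⇒∣[%]²+1 p 2∣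
  ... | 0 | _ | 2∣1 = contradiction 2∣1 (from-no (2 ∣? 1))
  ... | 1 | _ | _   = refl
  ... | suc (suc _) | s≤s (s≤s ()) | _

  ∣∧<⇒≡0 : ∀ {n k} → n ∣ k → k < n → k ≡ 0
  ∣∧<⇒≡0 {k = zero}  _   _   = refl
  ∣∧<⇒≡0 {k = suc _} n∣k k<n = contradiction n∣k (>⇒∤ k<n)

  ∤⇒coprime : ∀ {p n} → Prime p → ¬ p ∣ n → Coprime n p
  ∤⇒coprime pr p∤n (d∣n , d∣p) with prime⇒irreducible pr d∣p
  ... | inj₁ d≡1 = d≡1
  ... | inj₂ refl = contradiction d∣n p∤n

open Residues

module Congruences where
  open import Data.Integer.Base using (ℤ; +_; _+_; _-_; _*_; ∣_∣; 1ℤ)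
  open import Data.Integer.Properties
  open import Data.Integer.Divisibility.Signed
  open import Data.Integer.Tactic.RingSolver using (solve-∀)
  import Data.Integer.Coprimality as ℤ
  open import Data.Nat.Base as ℕ using (ℕ; NonZero)
  open import Data.Nat.Coprimality using (Coprime)
  import Data.Nat.DivMod as ℕ
  import Data.Nat.Divisibility as ℕ
  open import Data.Nat.Primality using (prime?)
  import Data.Nat.Properties as ℕ

  RootMod : ℤ → ℤ → Set
  RootMod m x = m ∣ x * x + 1ℤ

  roots⇒∣[x-X][x+X] : ∀ {m} x X → RootMod m x → RootMod m X → m ∣ (x - X) * (x + X)
  roots⇒∣[x-X][x+X] x X mx mX = subst (_ ∣_) (difference-of-squares x X) (∣m∣n⇒∣m-n mx mX)
    where
    difference-of-squares : ∀ x X → (x * x + 1ℤ) - (X * X + 1ℤ) ≡ (x - X) * (x + X)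
    difference-of-squares = solve-∀

  roots⇒∣12[b'-b] : ∀ {m} a b a' b' → RootMod m a → RootMod m b → RootMod m a' → RootMod m b' →
                    m ∣ (a + + 2 * b) - (a' + + 2 * b') → m ∣ + 12 * (b' - b)
  roots⇒∣12[b'-b] {m} a b a' b' ma mb ma' mb' mE =
    subst (m ∣_) (sym (twelve-d a b a' b'))
      (∣m∣n⇒∣m-n (∣n⇒∣m*n (a' - + 2 * b') m∣4d[a'+2b']) (∣n⇒∣m*n (+ 4 * (b' - b)) m∣[a'+2b'][a'-2b']-3))
    where
    -- a - a' = E + 2d, so (a - a')(a + a') = E (E + 4d + 2a') + 4d² + 4d a'.
    four-d : ∀ a b a' b' →
      let E = (a + + 2 * b) - (a' + + 2 * b'); d = b' - b in
      + 4 * d * (a' + + 2 * b') ≡ (a - a') * (a + a') - E * (E + + 4 * d + + 2 * a') + + 4 * (d * (b' + b))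
    four-d = solve-∀
    three : ∀ a' b' → (a' + + 2 * b') * (a' - + 2 * b') - + 3 ≡ (a' * a' + 1ℤ) - + 4 * (b' * b' + 1ℤ)
    three = solve-∀
    twelve-d : ∀ a b a' b' → let d = b' - b in
      + 12 * d ≡ (a' - + 2 * b') * (+ 4 * d * (a' + + 2 * b')) - + 4 * d * ((a' + + 2 * b') * (a' - + 2 * b') - + 3)
    twelve-d = solve-∀
    m∣4d[a'+2b'] : m ∣ + 4 * (b' - b) * (a' + + 2 * b')
    m∣4d[a'+2b'] = subst (m ∣_) (sym (four-d a b a' b'))
      (∣m∣n⇒∣m+n (∣m∣n⇒∣m-n (roots⇒∣[x-X][x+X] a a' ma ma') (∣m⇒∣m*n _ mE))
                 (∣n⇒∣m*n (+ 4) (roots⇒∣[x-X][x+X] b' b mb' mb)))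
    m∣[a'+2b'][a'-2b']-3 : m ∣ (a' + + 2 * b') * (a' - + 2 * b') - + 3
    m∣[a'+2b'][a'-2b']-3 = subst (m ∣_) (sym (three a' b')) (∣m∣n⇒∣m-n ma' (∣n⇒∣m*n (+ 4) mb'))

  coprime-cancel : ∀ {n k} i → Coprime n k → + n ∣ + k * i → + n ∣ i
  coprime-cancel {n} {k} i n⊥k n∣ki = ∣ᵤ⇒∣ (ℤ.coprime-divisor (+ n) (+ k) i n⊥k (∣⇒∣ᵤ n∣ki))

  odd-∣4*⇒∣ : ∀ {n} i → ¬ 2 ℕ.∣ n → + n ∣ + 4 * i → + n ∣ i
  odd-∣4*⇒∣ {n} i 2∤n n∣4i = cancel2 i (cancel2 (+ 2 * i) (subst (_ ∣_) (*-assoc (+ 2) (+ 2) i) n∣4i))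
    where
    cancel2 : ∀ j → + n ∣ + 2 * j → + n ∣ j
    cancel2 j = coprime-cancel j (∤⇒coprime (from-yes (prime? 2)) 2∤n)

  ∣12*⇒∣ : ∀ {q} d → ¬ 3 ℕ.∣ q → ¬ 4 ℕ.∣ q → (2 ℕ.∣ q → + 2 ∣ d) → + q ∣ + 12 * d → + q ∣ d
  ∣12*⇒∣ {q} d 3∤q 4∤q 2∣q⇒2∣d q∣12d = ∣4*⇒∣ (coprime-cancel (+ 4 * d) 3⊥q q∣3[4d])
    where
    3⊥q : Coprime q 3
    3⊥q = ∤⇒coprime (from-yes (prime? 3)) 3∤q
    q∣3[4d] : + q ∣ + 3 * (+ 4 * d)
    q∣3[4d] = subst (_ ∣_) (*-assoc (+ 3) (+ 4) d) q∣12d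
    ∣4*⇒∣ : + q ∣ + 4 * d → + q ∣ d
    ∣4*⇒∣ q∣4d with 2 ℕ.∣? q
    ... | no 2∤q = odd-∣4*⇒∣ d 2∤q q∣4d
    ... | yes 2∣q@(ℕ.divides r q≡r*2) with 2∣q⇒2∣d 2∣q
    ...   | divides e d≡e*2 = subst₂ _∣_ (sym q≡r*2ℤ) (sym d≡e*2) (*-monoˡ-∣ (+ 2) r∣e)
      where
      q≡r*2ℤ : + q ≡ + r * + 2
      q≡r*2ℤ = trans (cong +_ q≡r*2) (pos-* r 2)
      2∤r : ¬ 2 ℕ.∣ r
      2∤r 2∣r = 4∤q (subst (4 ℕ.∣_) (sym q≡r*2) (ℕ.*-monoˡ-∣ 2 2∣r))
      r*2∣4e*2 : + r * + 2 ∣ (+ 4 * e) * + 2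
      r*2∣4e*2 = subst₂ _∣_ q≡r*2ℤ (trans (cong (+ 4 *_) d≡e*2) (sym (*-assoc (+ 4) e (+ 2)))) q∣4d
      r∣e : + r ∣ e
      r∣e = odd-∣4*⇒∣ e 2∤r (*-cancelʳ-∣ (+ 2) r*2∣4e*2)

  pos-+* : ∀ r a n → + (r ℕ.+ a ℕ.* n) ≡ + r + + a * + n
  pos-+* r a n = trans (pos-+ r (a ℕ.* n)) (cong (_+_ (+ r)) (pos-* a n))

  %-≡⇒∣- : ∀ m o {n} .{{_ : NonZero n}} → m ℕ.% n ≡ o ℕ.% n → + n ∣ + m - + o
  %-≡⇒∣- m o {n} m≡o = divides (+ (m ℕ./ n) - + (o ℕ./ n)) (begin
    + m - + o
      ≡⟨ cong₂ (λ i j → + i - + j) (ℕ.m≡m%n+[m/n]*n m n) (ℕ.m≡m%n+[m/n]*n o n) ⟩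
    + (m ℕ.% n ℕ.+ m ℕ./ n ℕ.* n) - + (o ℕ.% n ℕ.+ o ℕ./ n ℕ.* n)
      ≡⟨ cong₂ _-_ (pos-+* (m ℕ.% n) (m ℕ./ n) n) (pos-+* (o ℕ.% n) (o ℕ./ n) n) ⟩
    (+ (m ℕ.% n) + + (m ℕ./ n) * + n) - (+ (o ℕ.% n) + + (o ℕ./ n) * + n)
      ≡⟨ cong (λ r → (+ (m ℕ.% n) + + (m ℕ./ n) * + n) - (+ r + + (o ℕ./ n) * + n)) (sym m≡o) ⟩
    (+ (m ℕ.% n) + + (m ℕ./ n) * + n) - (+ (m ℕ.% n) + + (o ℕ./ n) * + n)
      ≡⟨ cancel-remainder (+ (m ℕ.% n)) (+ (m ℕ./ n)) (+ (o ℕ./ n)) (+ n) ⟩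
    (+ (m ℕ./ n) - + (o ℕ./ n)) * + n ∎)
    where
    open ≡-Reasoning
    cancel-remainder : ∀ r i j n → (r + i * n) - (r + j * n) ≡ (i - j) * n
    cancel-remainder = solve-∀

  n∣m-o⇒m≡o : ∀ {m n o} → m ℕ.< n → o ℕ.< n → + n ∣ + m - + o → m ≡ o
  n∣m-o⇒m≡o {m} {n} {o} m<n o<n n∣m-o =
    +-injective (i-j≡0⇒i≡j (+ m) (+ o) (∣i∣≡0⇒i≡0 (∣∧<⇒≡0 (∣⇒∣ᵤ n∣m-o) ∣m-o∣<n)))
    where
    ∣m-o∣<n : ∣ + m - + o ∣ ℕ.< n
    ∣m-o∣<n = subst (ℕ._< n) (cong ∣_∣ (sym ([+m]-[+n]≡m⊖n m o)))
                (ℕ.≤-<-trans (∣m⊝n∣≤m⊔n m o) (ℕ.⊔-lub m<n o<n))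

  ∣sq+1⇒RootMod : ∀ {q} a → q ℕ.∣ a ℕ.* a ℕ.+ 1 → RootMod (+ q) (+ a)
  ∣sq+1⇒RootMod {q} a q∣ = subst (+ q ∣_) (trans (pos-+ (a ℕ.* a) 1) (cong (_+ 1ℤ) (pos-* a a))) (∣ᵤ⇒∣ q∣)

  reducedRoot-pair-injective : ∀ {q a b a' b'} .{{_ : NonZero q}} →
    ReducedRoot q a → ReducedRoot q b → ReducedRoot q a' → ReducedRoot q b' →
    (a ℕ.+ 2 ℕ.* b) ℕ.% q ≡ (a' ℕ.+ 2 ℕ.* b') ℕ.% q → a ≡ a' × b ≡ b'
  reducedRoot-pair-injective {q} {a} {b} {a'} {b'} (a<q , q∣a) (b<q , q∣b) (a'<q , q∣a') (b'<q , q∣b') eq =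
    n∣m-o⇒m≡o a<q a'<q q∣a-a' , sym (n∣m-o⇒m≡o b'<q b<q q∣b'-b)
    where
    ∤q : ∀ {k} → (∀ p → ¬ k ℕ.∣ p ℕ.* p ℕ.+ 1) → ¬ k ℕ.∣ q
    ∤q noRoot k∣q = noRoot a (ℕ.∣-trans k∣q q∣a)
    odd : ∀ p → 2 ℕ.∣ q → q ℕ.∣ p ℕ.* p ℕ.+ 1 → p ℕ.% 2 ≡ 1
    odd p 2∣q q∣p = 2∣sq+1⇒odd p (ℕ.∣-trans 2∣q q∣p)
    2∣q⇒2∣b'-b : 2 ℕ.∣ q → + 2 ∣ + b' - + b
    2∣q⇒2∣b'-b 2∣q = %-≡⇒∣- b' b (trans (odd b' 2∣q q∣b') (sym (odd b 2∣q q∣b)))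
    q∣E : + q ∣ (+ a + + 2 * + b) - (+ a' + + 2 * + b')
    q∣E = subst (+ q ∣_) (cong₂ _-_ (pos-+* a 2 b) (pos-+* a' 2 b'))
            (%-≡⇒∣- (a ℕ.+ 2 ℕ.* b) (a' ℕ.+ 2 ℕ.* b') eq)
    q∣12[b'-b] : + q ∣ + 12 * (+ b' - + b)
    q∣12[b'-b] = roots⇒∣12[b'-b] (+ a) (+ b) (+ a') (+ b')
      (∣sq+1⇒RootMod a q∣a) (∣sq+1⇒RootMod b q∣b) (∣sq+1⇒RootMod a' q∣a') (∣sq+1⇒RootMod b' q∣b') q∣E
    q∣b'-b : + q ∣ + b' - + b
    q∣b'-b = ∣12*⇒∣ (+ b' - + b) (∤q ¬3∣sq+1) (∤q ¬4∣sq+1) 2∣q⇒2∣b'-b q∣12[b'-b]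
    q∣a-a' : + q ∣ + a - + a'
    q∣a-a' = subst (+ q ∣_) (difference (+ a) (+ b) (+ a') (+ b')) (∣m∣n⇒∣m+n q∣E (∣n⇒∣m*n (+ 2) q∣b'-b))
      where
      difference : ∀ a b a' b' → (a + + 2 * b) - (a' + + 2 * b') + + 2 * (b' - b) ≡ a - a'
      difference = solve-∀

open Congruences

open import Data.Fin using (Fin; fromℕ<)
import Data.Fin.Properties as Fin
open import Data.List using (List; _∷_; length; lookup; filter; upTo)
open import Data.List.Membership.Propositional.Properties using (∈-lookup; ∈-filter⁻; ∈-upTo⁻)
import Data.List.Relation.Unary.All as All
open import Data.List.Relation.Unary.AllPairs using (_∷_)
open import Data.List.Relation.Unary.Unique.Propositional using (Unique)
open import Data.List.Relation.Unary.Unique.Propositional.Properties using (filter⁺; upTo⁺)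
open import Data.Nat.Base using (ℕ; zero; suc; _+_; _*_; _≤_)
open import Data.Nat.DivMod using (_%_; m%n<n)
open import Data.Nat.Properties using (≤-refl)
open import Function.Bundles using (Injection)
open import Function.Definitions using (Injective)
open import Function.Base using (_∘_)
open import Function.Properties.Inverse using (↔⇒↣)

lookup-injective : ∀ {A : Set} {xs : List A} → Unique xs → Injective _≡_ _≡_ (lookup xs)
lookup-injective {xs = _ ∷ _} (_     ∷ _)  {Fin.zero}  {Fin.zero}  _  = refl
lookup-injective {xs = _ ∷ _} (x∉xs ∷ _)  {Fin.zero}  {Fin.suc j} eq = contradiction eq (All.lookup x∉xs (∈-lookup j))
lookup-injective {xs = _ ∷ _} (x∉xs ∷ _)  {Fin.suc i} {Fin.zero}  eq = contradiction (sym eq) (All.lookup x∉xs (∈-lookup i))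
lookup-injective {xs = _ ∷ _} (_ ∷ unique) {Fin.suc i} {Fin.suc j} eq = cong Fin.suc (lookup-injective unique eq)

pairs-injective⇒≤ : ∀ {m n k} {f : Fin m × Fin n → Fin k} → Injective _≡_ _≡_ f → m * n ≤ k
pairs-injective⇒≤ {m} {n} f-injective =
  Fin.injective⇒≤ (Injection.injective (↔⇒↣ (Fin.*↔× {m} {n})) ∘ f-injective)

mainTheorem11 : (q : ℕ) → 1 ≤ q → s q * s q ≤ q
mainTheorem11 (suc zero) _ = ≤-refl
mainTheorem11 q@(suc (suc _)) _ = pairs-injective⇒≤ encode-injective
  where
  roots : List ℕ
  roots = filter (isSqrtMinusOne? q) (upTo q)
  root : Fin (length roots) → ℕ
  root = lookup roots
  root-isReducedRoot : ∀ i → ReducedRoot q (root i)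
  root-isReducedRoot i with ∈-filter⁻ (isSqrtMinusOne? q) (∈-lookup i)
  ... | r∈upTo , (_ , q∣r²+1) = ∈-upTo⁻ r∈upTo , q∣r²+1
  encode : Fin (length roots) × Fin (length roots) → Fin q
  encode (i , j) = fromℕ< (m%n<n (root i + 2 * root j) q)
  encode-injective : Injective _≡_ _≡_ encode
  encode-injective {i , j} {i' , j'} eq = cong₂ _,_ (root-injective (proj₁ same)) (root-injective (proj₂ same))
    where
    root-injective : Injective _≡_ _≡_ root
    root-injective = lookup-injective (filter⁺ (isSqrtMinusOne? q) (upTo⁺ q))
    same : root i ≡ root i' × root j ≡ root j'
    same = reducedRoot-pair-injective (root-isReducedRoot i) (root-isReducedRoot j) (root-isReducedRoot i') (root-isReducedRoot j')
             (Fin.fromℕ<-injective _ _ (m%n<n (root i + 2 * root j) q) (m%n<n (root i' + 2 * root j') q) eq)
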